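{- Every split permutation graph with $n$ vertices is contained, as an induced subgraph, in a symmetric split permutation graph with $2n$ vertices.
   Context: All graphs are finite, simple, undirected. $N(v)$ is the neighbourhood of $v$. A graph is split if its vertex set can be partitioned into a clique $C$ and an independent set $I$; we write $G=(C,I,E)$. The permutation graph of a permutation $\pi$ of $[m]$ has vertex set $[m]$, with $i<j$ adjacent iff $\pi^{ -1}(i)>\pi^{ -1}(j)$ (i.e. the two values form an inversion); a permutation graph is a graph isomorphic to such a graph. A split permutation graph is a split graph that is a permutation graph. The vicinal quasi-order is $x\sqsubseteq y$ iff $N(x)\subseteq N(y)\cup\{y\}$; a vicinal chain is a set of pairwise comparable vertices; a threshold graph is a graph whose vertex set is a vicinal chain. A split graph $G=(C,I,E)$ is a permutation graph iff (1) $C$ can be partitioned into at most two sets $C^1,C^2$ with $G[C^1\cup I]$ and $G[C^2\cup I]$ threshold, and (2) $I$ can be partitioned into at most two sets $I^1,I^2$ with $G[C\cup I^1]$ and $G[C\cup I^2]$ threshold. A split permutation graph $G=(C,I,E)$ is symmetric if it admits partitions $C=C^1\cup C^2$, $I=I^1\cup I^2$ such that (3) for each $k\in\{1,2\}$, $G[C^k\cup I^k]$ is a universal threshold graph, meaning $|C^k|=|I^k|=m_k$ and one can enumerate $C^k=\{c_1,\dots,c_{m_k}\}$, $I^k=\{i_1,\dots,i_{m_k}\}$ so that $N(i_j)\cap C^k=\{c_1,\dots,c_j\}$ for every $j$. -}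

module Defs where

open import Data.Nat using (ℕ)
open import Data.Fin using (Fin; _<_; _≤_)
open import Data.Bool using (Bool; true; false)
open import Data.Product using (Σ; ∃; _×_; _,_)
open import Data.Sum using (_⊎_)
open import Relation.Nullary using (¬_)
open import Relation.Binary.PropositionalEquality using (_≡_)
open import Function.Definitions using (Injective)
open import Function.Bundles using (_⇔_)
open import Data.Fin.Permutation using (Permutation′; _⟨$⟩ʳ_; _⟨$⟩ˡ_)

record Graph (n : ℕ) : Set where
  field
    adj    : Fin n → Fin n → Bool
    sym    : ∀ u v → adj u v ≡ adj v u
    irrefl : ∀ v → adj v v ≡ false
open Graph public

Adj : ∀ {n} → Graph n → Fin n → Fin n → Set
Adj G u v = adj G u v ≡ true

PermAdj : ∀ {m} → Permutation′ m → Fin m → Fin m → Set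
PermAdj π i j =
    (i < j × (π ⟨$⟩ˡ j) < (π ⟨$⟩ˡ i))
  ⊎ (j < i × (π ⟨$⟩ˡ i) < (π ⟨$⟩ˡ j))

-- G is isomorphic to the permutation graph of some permutation.
-- (An isomorphism forces the permutation to be on [n]; σ is the vertex bijection.)
IsPermutationGraph : ∀ {n} → Graph n → Set
IsPermutationGraph {n} G =
  Σ (Permutation′ n) λ π → Σ (Permutation′ n) λ σ →
    ∀ u v → Adj G u v ⇔ PermAdj π (σ ⟨$⟩ʳ u) (σ ⟨$⟩ʳ v)

-- s v ≡ true means v ∈ C (clique), s v ≡ false means v ∈ I (independent set).
IsSplitPartition : ∀ {n} → Graph n → (Fin n → Bool) → Set
IsSplitPartition {n} G s =
    (∀ u v → ¬ (u ≡ v) → s u ≡ true → s v ≡ true → Adj G u v)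
  × (∀ u v → s u ≡ false → s v ≡ false → ¬ Adj G u v)

IsSplit : ∀ {n} → Graph n → Set
IsSplit {n} G = Σ (Fin n → Bool) λ s → IsSplitPartition G s

IsSplitPermutation : ∀ {n} → Graph n → Set
IsSplitPermutation G = IsSplit G × IsPermutationGraph G

UniversalThreshold : ∀ {n} → Graph n → (Fin n → Set) → (Fin n → Set) → Set
UniversalThreshold {n} G Cs Is =
  Σ ℕ λ m → Σ (Fin m → Fin n) λ c → Σ (Fin m → Fin n) λ i →
      Injective _≡_ _≡_ c
    × Injective _≡_ _≡_ i
    × (∀ v → Cs v ⇔ ∃ λ j → c j ≡ v)
    × (∀ v → Is v ⇔ ∃ λ j → i j ≡ v)
    × (∀ j w → Cs w → (Adj G (i j) w ⇔ ∃ λ l → (c l ≡ w) × (l ≤ j)))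

-- Symmetric split permutation graph: a split permutation graph admitting a split
-- partition (C, I) (given by s) and partitions C = C¹ ∪ C², I = I¹ ∪ I² (given by
-- the label p, k ∈ Bool indexing the two parts) such that each G[Cᵏ ∪ Iᵏ] is a
-- universal threshold graph.
IsSymmetricSplitPermutation : ∀ {n} → Graph n → Set
IsSymmetricSplitPermutation {n} G =
  IsSplitPermutation G ×
  (Σ (Fin n → Bool) λ s → Σ (Fin n → Bool) λ p →
      IsSplitPartition G s
    × (∀ (k : Bool) → UniversalThreshold G
          (λ v → (s v ≡ true) × (p v ≡ k))
          (λ v → (s v ≡ false) × (p v ≡ k))))

InducedSubgraphOf : ∀ {n N} → Graph n → Graph N → Set
InducedSubgraphOf {n} {N} G H =
  Σ (Fin n → Fin N) λ f →
    Injective _≡_ _≡_ f × (∀ u v → adj G u v ≡ adj H (f u) (f v))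

-- Draw G as the diagram of its permutation: point x at height π⁻¹(x), two points adjacent exactly
-- when they are inverted.  The clique is then a decreasing chain and the independent set an
-- increasing one.  Let the left part be the longest initial segment of positions on which every
-- clique point lies above every independent point; by maximality, on the remaining right part every
-- clique point lies below every independent point.  Give each point a twin of the opposite type,
-- horizontally right next to it and vertically right next to the nearest point of the twin's type,
-- so that both chains stay monotone.  Within a part, the independent copy of a pair then sees exactly
-- the clique copies of the pairs up to it (from the left in the left part, from the right in the
-- right part): each part is a universal threshold graph.  The originals induce G, and sorting all 2n
-- points by height yields the permutation of the new graph.

module Submission where

open import Defs hiding (sym; irrefl)
open import Data.Nat using (ℕ; _*_)
open import Data.Product using (Σ; _×_)

open import Data.Bool.Base using (Bool; true; false; _xor_)
open import Data.Bool.Properties using (not-involutive; not-¬; ¬-not) renaming (_≟_ to _≟ᵇ_)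
open import Data.Empty using (⊥)
open import Data.Fin.Base as F using (Fin; toℕ; fromℕ<; combine; remQuot)
open import Data.Fin.Permutation as P using (Permutation′; _⟨$⟩ʳ_; _⟨$⟩ˡ_; inverseʳ)
open import Data.Fin.Properties as F using (toℕ-injective; toℕ-fromℕ<; toℕ<n; 2↔Bool)
open import Data.Fin.Subset using (Subset; _∈_; ∣_∣)
open import Data.Fin.Subset.Properties using (p⊂q⇒∣p∣<∣q∣; ∣⊤∣≡n; ∈⊤)
open import Data.List.Base using (List; map; filter; allFin)
open import Data.List.Extrema.Nat
  using (max; min; v≤max⁺; max<v⁺; max≤v⁺; min≤v⁺; v<min⁺; v≤min⁺; min≤⊤)
open import Data.List.Membership.Propositional using () renaming (_∈_ to _∈ₗ_)
open import Data.List.Membership.Propositional.Properties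
  using (∈-map∘filter⁺; ∈-map∘filter⁻; ∈-allFin)
open import Data.List.Relation.Unary.All as All using (All)
import Data.List.Relation.Unary.Any as Any
open import Data.Nat.Base as ℕ using (zero; suc; z≤n; s≤s; _+_; _∸_; _≤_; _<_)
import Data.Nat.Properties as ℕ
open import Data.Product using (∃; _,_; proj₁; proj₂)
open import Data.Product.Relation.Binary.Lex.Strict using (×-strictTotalOrder)
open import Data.Sum.Base using (inj₁; inj₂)
open import Data.Vec.Base using (tabulate)
open import Data.Vec.Properties using (lookup∘tabulate; lookup⇒[]=; []=⇒lookup)
open import Function.Base using (_∘_)
open import Function.Bundles using (_⇔_; mk⇔; mk⤖; Equivalence; Inverse)
open import Function.Consequences.Propositional using (strictlySurjective⇒surjective)
open import Function.Construct.Composition using (_⇔-∘_)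
open import Function.Construct.Identity using (⇔-id)
open import Function.Construct.Symmetry using (⇔-sym)
open import Function.Definitions using (Injective; Surjective; StrictlySurjective)
open import Function.Properties.Bijection using (⤖⇒↔)
open import Level using (0ℓ)
import Relation.Binary.Bundles as B
open import Relation.Binary.Definitions using (Tri; tri<; tri≈; tri>)
open import Relation.Binary.PropositionalEquality
open import Relation.Nullary using (Dec; yes; no; does; ¬_; contradiction)
open import Relation.Nullary.Decidable using (dec-true; dec-false; _×-dec_; _⊎-dec_; _→-dec_)
open import Relation.Unary using (Pred; Decidable)

dec-true⁻¹ : ∀ {a} {A : Set a} (a? : Dec A) → does a? ≡ true → A
dec-true⁻¹ (yes a) _ = a

dec-false⁻¹ : ∀ {a} {A : Set a} (a? : Dec A) → does a? ≡ false → ¬ A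
dec-false⁻¹ (no ¬a) _ = ¬a

≡true⇔⇒≡ : ∀ {a b : Bool} → (a ≡ true ⇔ b ≡ true) → a ≡ b
≡true⇔⇒≡ {false} {false} _ = refl
≡true⇔⇒≡ {false} {true}  a⇔b = Equivalence.from a⇔b refl
≡true⇔⇒≡ {true}  {false} a⇔b = sym (Equivalence.to a⇔b refl)
≡true⇔⇒≡ {true}  {true}  _ = refl

xor-cancelˡ : ∀ a b → a xor (a xor b) ≡ b
xor-cancelˡ false b = refl
xor-cancelˡ true b = not-involutive b

injective⇒strictlySurjective : ∀ {N} {f : Fin N → Fin N} →
  Injective _≡_ _≡_ f → StrictlySurjective _≡_ f
injective⇒strictlySurjective {suc N} {f} f-inj t with F.any? (λ a → f a F.≟ t)
... | yes hit = hit
... | no miss =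
  let i , j , i<j , eq = F.pigeonhole (ℕ.n<1+n N) avoid-t
  in contradiction (f-inj (F.punchOut-injective (avoids i) (avoids j) eq)) (F.<⇒≢ i<j)
  where
  avoids : ∀ a → t ≢ f a
  avoids a e = miss (a , sym e)
  avoid-t : Fin (suc N) → Fin N
  avoid-t a = F.punchOut (avoids a)

2*m+0<2*n+1⇔m≤n : ∀ {m n} → 2 * m + 0 < 2 * n + 1 ⇔ m ≤ n
2*m+0<2*n+1⇔m≤n {m} {n} = mk⇔ to (λ m≤n → ℕ.+-mono-≤-< (ℕ.*-monoʳ-≤ 2 m≤n) (s≤s z≤n))
  where
  to : 2 * m + 0 < 2 * n + 1 → m ≤ n
  to 2m<2n+1 = ℕ.*-cancelˡ-≤ 2 (subst₂ _≤_ (ℕ.+-identityʳ (2 * m)) refl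
    (ℕ.s≤s⁻¹ (subst (2 * m + 0 <_) (ℕ.+-comm (2 * n) 1) 2m<2n+1)))

combine-0<combine-1 : ∀ {m} {x x' : Fin m} →
  combine {n = 2} x F.zero F.< combine x' (F.suc F.zero) ⇔ x F.≤ x'
combine-0<combine-1 {x = x} {x'} = subst₂ (λ p q → p < q ⇔ x F.≤ x')
  (sym (F.toℕ-combine {n = 2} x F.zero)) (sym (F.toℕ-combine {n = 2} x' (F.suc F.zero))) 2*m+0<2*n+1⇔m≤n

inject≤-≤ : ∀ {k n} .{p q : k ≤ n} {i j : Fin k} → F.inject≤ i p F.≤ F.inject≤ j q ⇔ i F.≤ j
inject≤-≤ {p = p} {q} {i} {j} =
  subst₂ (λ a b → a ≤ b ⇔ i F.≤ j) (sym (F.toℕ-inject≤ i p)) (sym (F.toℕ-inject≤ j q)) (⇔-id _)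

opposite-≤ : ∀ {n} {i j : Fin n} → F.opposite i F.≤ F.opposite j ⇔ j F.≤ i
opposite-≤ {n} {i} {j} =
  subst₂ (λ a b → a ≤ b ⇔ j F.≤ i) (sym (F.opposite-prop i)) (sym (F.opposite-prop j))
    (mk⇔ (λ le → ℕ.≮⇒≥ λ i<j → ℕ.<⇒≱ (ℕ.∸-monoʳ-< (s≤s i<j) (toℕ<n j)) le) (ℕ.∸-monoʳ-≤ n ∘ s≤s))

⟨$⟩ˡ-injective : ∀ {m} (ρ : Permutation′ m) → Injective _≡_ _≡_ (ρ ⟨$⟩ˡ_)
⟨$⟩ˡ-injective ρ eq = trans (sym (inverseʳ ρ)) (trans (cong (ρ ⟨$⟩ʳ_) eq) (inverseʳ ρ))

-- Extrema over decidable subsets of Fin n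

module _ {n p} {P : Pred (Fin n) p} (P? : Decidable P) (f : Fin n → ℕ) where
  private
    values : List ℕ
    values = map f (filter P? (allFin n))

    ∈-values : ∀ {z} → P z → f z ∈ₗ values
    ∈-values {z} Pz = ∈-map∘filter⁺ f P? (z , ∈-allFin z , refl , Pz)

    all-values : ∀ {q} {Q : ℕ → Set q} → (∀ {z} → P z → Q (f z)) → All Q values
    all-values {Q = Q} bound = All.tabulate λ v∈ → bound-value (∈-map∘filter⁻ f P? v∈)
      where
      bound-value : ∀ {v} → ∃ (λ z → z ∈ₗ allFin n × v ≡ f z × P z) → Q v
      bound-value (_ , _ , refl , Pz) = bound Pz

  maxOver : ℕ
  maxOver = max 0 values

  minOver : ℕ → ℕ
  minOver top = min top values

  ≤-maxOver : ∀ {z} → P z → f z ≤ maxOver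
  ≤-maxOver Pz = v≤max⁺ 0 values (inj₂ (Any.map ℕ.≤-reflexive (∈-values Pz)))

  maxOver-< : ∀ {b} → 0 < b → (∀ {z} → P z → f z < b) → maxOver < b
  maxOver-< 0<b bound = max<v⁺ 0<b (all-values bound)

  maxOver-≤ : ∀ {b} → (∀ {z} → P z → f z ≤ b) → maxOver ≤ b
  maxOver-≤ bound = max≤v⁺ z≤n (all-values bound)

  minOver-≤ : ∀ top {z} → P z → minOver top ≤ f z
  minOver-≤ top Pz = min≤v⁺ top values (inj₂ (Any.map (ℕ.≤-reflexive ∘ sym) (∈-values Pz)))

  minOver-≤-top : ∀ top → minOver top ≤ top
  minOver-≤-top top = min≤⊤ top values

  <-minOver : ∀ {b top} → b < top → (∀ {z} → P z → b < f z) → b < minOver top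
  <-minOver b<top bound = v<min⁺ b<top (all-values bound)

  ≤-minOver : ∀ {b top} → b ≤ top → (∀ {z} → P z → b ≤ f z) → b ≤ minOver top
  ≤-minOver b≤top bound = v≤min⁺ b≤top (all-values bound)

module _ {n p q} {P : Pred (Fin n) p} {Q : Pred (Fin n) q} (P? : Decidable P) (Q? : Decidable Q)
  (f : Fin n → ℕ) (P⊆Q : ∀ {z} → P z → Q z) where

  maxOver-mono : maxOver P? f ≤ maxOver Q? f
  maxOver-mono = maxOver-≤ P? f (≤-maxOver Q? f ∘ P⊆Q)

  minOver-antitone : ∀ top → minOver Q? f top ≤ minOver P? f top
  minOver-antitone top = ≤-minOver P? f (minOver-≤-top Q? f top) (minOver-≤ Q? f top ∘ P⊆Q)

downClosed⇒initialSegment : ∀ {n} (b : Fin n → Bool) →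
  (∀ {x x'} → x' F.< x → b x ≡ true → b x' ≡ true) →
  Σ ℕ λ m → m ≤ n × (∀ x → b x ≡ true ⇔ toℕ x < m)
downClosed⇒initialSegment {zero} b closed = 0 , z≤n , λ ()
downClosed⇒initialSegment {suc n} b closed with b F.zero in b0
... | false = 0 , z≤n , λ x → mk⇔ (λ bx → contradiction (trans (sym (first-true x bx)) b0) λ ()) (λ ())
  where
  first-true : ∀ x → b x ≡ true → b F.zero ≡ true
  first-true F.zero bx = bx
  first-true (F.suc x) bx = closed (s≤s z≤n) bx
... | true with m , m≤n , segment ← downClosed⇒initialSegment (b ∘ F.suc) (closed ∘ s≤s) =
  suc m , s≤s m≤n , λ
    { F.zero → mk⇔ (λ _ → s≤s z≤n) (λ _ → b0)
    ; (F.suc x) → mk⇔ (s≤s ∘ Equivalence.to (segment x)) (Equivalence.from (segment x) ∘ ℕ.s≤s⁻¹)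
    }

-- Sorting permutations and permutation graphs

module _ {a ℓ₁ ℓ₂} (O : B.StrictTotalOrder a ℓ₁ ℓ₂) where
  open B.StrictTotalOrder O using (_≈_; compare; irrefl; module Eq)
    renaming (Carrier to A; _<_ to _≺_; _<?_ to _≺?_; trans to ≺-trans)

  rankingPermutation : ∀ {N} (key : Fin N → A) → (∀ {u v} → key u ≈ key v → u ≡ v) →
    Σ (Permutation′ N) λ ρ → ∀ {u v} → key u ≺ key v → ρ ⟨$⟩ˡ u F.< ρ ⟨$⟩ˡ v
  rankingPermutation {N} key key-inj =
    P.flip (⤖⇒↔ (mk⤖ (rank-injective , rank-surjective))) , rank-mono
    where
    below : Fin N → Subset N
    below u = tabulate λ w → does (key w ≺? key u)

    ∈-below⁺ : ∀ {w u} → key w ≺ key u → w ∈ below u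
    ∈-below⁺ {w} {u} w<u =
      lookup⇒[]= w _ (trans (lookup∘tabulate _ w) (dec-true (key w ≺? key u) w<u))

    ∈-below⁻ : ∀ {w u} → w ∈ below u → key w ≺ key u
    ∈-below⁻ {w} {u} w∈u =
      dec-true⁻¹ (key w ≺? key u) (trans (sym (lookup∘tabulate _ w)) ([]=⇒lookup w∈u))

    below-self : ∀ u → u ∈ below u → ⊥
    below-self u u∈u = irrefl Eq.refl (∈-below⁻ u∈u)

    rank : Fin N → Fin N
    rank u = fromℕ< (subst (∣ below u ∣ <_) (∣⊤∣≡n N)
                            (p⊂q⇒∣p∣<∣q∣ ((λ _ → ∈⊤) , u , ∈⊤ , below-self u)))

    rank-mono : ∀ {u v} → key u ≺ key v → rank u F.< rank v
    rank-mono {u} {v} u<v = subst₂ ℕ._<_ (sym (toℕ-fromℕ< _)) (sym (toℕ-fromℕ< _))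
      (p⊂q⇒∣p∣<∣q∣ ((λ w∈u → ∈-below⁺ (≺-trans (∈-below⁻ w∈u) u<v)) , u , ∈-below⁺ u<v , below-self u))

    rank-injective : Injective _≡_ _≡_ rank
    rank-injective {u} {v} eq with compare (key u) (key v)
    ... | tri< u<v _ _ = contradiction eq (F.<⇒≢ (rank-mono u<v))
    ... | tri≈ _ u≈v _ = key-inj u≈v
    ... | tri> _ _ v<u = contradiction (sym eq) (F.<⇒≢ (rank-mono v<u))

    rank-surjective : Surjective _≡_ _≡_ rank
    rank-surjective = strictlySurjective⇒surjective (injective⇒strictlySurjective rank-injective)

module _ {a ℓ₁ ℓ₂} (O : B.StrictTotalOrder a ℓ₁ ℓ₂) where
  open B.StrictTotalOrder O using () renaming (Carrier to A; _<_ to _≺_)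

  sortingPermutation : ∀ {N} (key : Fin N → A) →
    Σ (Permutation′ N) λ ρ → ∀ {u v} → key u ≺ key v → ρ ⟨$⟩ˡ u F.< ρ ⟨$⟩ˡ v
  sortingPermutation {N} key
    with ρ , mono ← rankingPermutation (×-strictTotalOrder O (F.<-strictTotalOrder N))
                                       (λ u → key u , u) proj₂
    = ρ , λ u<v → mono (inj₁ u<v)

PermAdj? : ∀ {m} (ρ : Permutation′ m) u v → Dec (PermAdj ρ u v)
PermAdj? ρ u v =
  (u F.<? v ×-dec ρ ⟨$⟩ˡ v F.<? ρ ⟨$⟩ˡ u) ⊎-dec (v F.<? u ×-dec ρ ⟨$⟩ˡ u F.<? ρ ⟨$⟩ˡ v)

PermAdj-sym : ∀ {m} (ρ : Permutation′ m) {u v} → PermAdj ρ u v → PermAdj ρ v u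
PermAdj-sym ρ (inj₁ uv) = inj₂ uv
PermAdj-sym ρ (inj₂ vu) = inj₁ vu

PermAdj-irrefl : ∀ {m} (ρ : Permutation′ m) {u} → ¬ PermAdj ρ u u
PermAdj-irrefl ρ (inj₁ (u<u , _)) = F.<-irrefl refl u<u
PermAdj-irrefl ρ (inj₂ (u<u , _)) = F.<-irrefl refl u<u

permutationGraph : ∀ {m} → Permutation′ m → Graph m
permutationGraph ρ = record
  { adj    = λ u v → does (PermAdj? ρ u v)
  ; sym    = λ u v → ≡true⇔⇒≡ (mk⇔ (flip-adj u v) (flip-adj v u))
  ; irrefl = λ u → dec-false (PermAdj? ρ u u) (PermAdj-irrefl ρ)
  }
  where
  flip-adj : ∀ u v → does (PermAdj? ρ u v) ≡ true → does (PermAdj? ρ v u) ≡ true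
  flip-adj u v uv = dec-true (PermAdj? ρ v u) (PermAdj-sym ρ (dec-true⁻¹ (PermAdj? ρ u v) uv))

Adj-permutationGraph : ∀ {m} (ρ : Permutation′ m) u v → Adj (permutationGraph ρ) u v ⇔ PermAdj ρ u v
Adj-permutationGraph ρ u v = mk⇔ (dec-true⁻¹ (PermAdj? ρ u v)) (dec-true (PermAdj? ρ u v))

permutationGraph-isPermutationGraph : ∀ {m} (ρ : Permutation′ m) → IsPermutationGraph (permutationGraph ρ)
permutationGraph-isPermutationGraph ρ = ρ , P.id , Adj-permutationGraph ρ

module SortedPoints {a ℓ₁ ℓ₂} (O : B.StrictTotalOrder a ℓ₁ ℓ₂) {m}
  (key : Fin m → B.StrictTotalOrder.Carrier O) (ρ : Permutation′ m)
  (ρ-sorts : ∀ {u v} → B.StrictTotalOrder._<_ O (key u) (key v) → ρ ⟨$⟩ˡ u F.< ρ ⟨$⟩ˡ v) where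
  open B.StrictTotalOrder O using () renaming (_<_ to _≺_)

  PermAdj-keyBelow : ∀ {u v} → key v ≺ key u → PermAdj ρ u v ⇔ u F.< v
  PermAdj-keyBelow {u} {v} v<u = mk⇔ to (λ u<v → inj₁ (u<v , ρ-sorts v<u))
    where
    to : PermAdj ρ u v → u F.< v
    to (inj₁ (u<v , _)) = u<v
    to (inj₂ (_ , ρu<ρv)) = contradiction ρu<ρv (F.<-asym (ρ-sorts v<u))

  PermAdj-keyAbove : ∀ {u v} → key u ≺ key v → PermAdj ρ u v ⇔ v F.< u
  PermAdj-keyAbove {u} {v} u<v =
    mk⇔ (Equivalence.to below ∘ PermAdj-sym ρ) (PermAdj-sym ρ ∘ Equivalence.from below)
    where
    below : PermAdj ρ v u ⇔ v F.< u
    below = PermAdj-keyBelow u<v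

  isSplitPartition : (s : Fin m → Bool) →
    (∀ {u v} → s u ≡ true → s v ≡ true → u F.< v → key v ≺ key u) →
    (∀ {u v} → s u ≡ false → s v ≡ false → u F.< v → key u ≺ key v) →
    IsSplitPartition (permutationGraph ρ) s
  isSplitPartition s clique-decreasing independent-increasing = clique , independent
    where
    clique : ∀ u v → u ≢ v → s u ≡ true → s v ≡ true → Adj (permutationGraph ρ) u v
    clique u v u≢v su sv = Equivalence.from (Adj-permutationGraph ρ u v) (adjacent (F.<-cmp u v))
      where
      adjacent : Tri (u F.< v) (u ≡ v) (v F.< u) → PermAdj ρ u v
      adjacent (tri< u<v _ _) = Equivalence.from (PermAdj-keyBelow (clique-decreasing su sv u<v)) u<v
      adjacent (tri≈ _ u≡v _) = contradiction u≡v u≢v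
      adjacent (tri> _ _ v<u) = Equivalence.from (PermAdj-keyAbove (clique-decreasing sv su v<u)) v<u

    independent : ∀ u v → s u ≡ false → s v ≡ false → ¬ Adj (permutationGraph ρ) u v
    independent u v su sv uv with Equivalence.to (Adj-permutationGraph ρ u v) uv | F.<-cmp u v
    ... | adj | tri< u<v _ _ =
      F.<-asym u<v (Equivalence.to (PermAdj-keyAbove (independent-increasing su sv u<v)) adj)
    ... | adj | tri≈ _ refl _ = PermAdj-irrefl ρ adj
    ... | adj | tri> _ _ v<u =
      F.<-asym v<u (Equivalence.to (PermAdj-keyBelow (independent-increasing sv su v<u)) adj)

  PermAdj-transfer : ∀ {n} (π : Permutation′ n) (f : Fin n → Fin m) →
    (∀ {x x'} → x F.< x' → f x F.< f x') →
    (∀ {x x'} → π ⟨$⟩ˡ x F.< π ⟨$⟩ˡ x' → key (f x) ≺ key (f x')) →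
    ∀ x x' → PermAdj π x x' ⇔ PermAdj ρ (f x) (f x')
  PermAdj-transfer π f f-mono key-mono _ _ =
    mk⇔ to (λ { (inj₁ inv) → inj₁ (from inv) ; (inj₂ inv) → inj₂ (from inv) })
    where
    to : ∀ {x x'} → PermAdj π x x' → PermAdj ρ (f x) (f x')
    to (inj₁ (x<x' , πx'<πx)) = inj₁ (f-mono x<x' , ρ-sorts (key-mono πx'<πx))
    to (inj₂ (x'<x , πx<πx')) = inj₂ (f-mono x'<x , ρ-sorts (key-mono πx<πx'))

    from : ∀ {x x'} → f x F.< f x' × ρ ⟨$⟩ˡ f x' F.< ρ ⟨$⟩ˡ f x →
           x F.< x' × π ⟨$⟩ˡ x' F.< π ⟨$⟩ˡ x
    from {x} {x'} (fx<fx' , ρfx'<ρfx) with F.<-cmp x x' | F.<-cmp (π ⟨$⟩ˡ x') (π ⟨$⟩ˡ x)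
    ... | tri< x<x' _ _ | tri< πx'<πx _ _ = x<x' , πx'<πx
    ... | tri< _ _ _    | tri≈ _ πx'≡πx _ =
      contradiction (⟨$⟩ˡ-injective π πx'≡πx) (F.<⇒≢ fx<fx' ∘ cong f ∘ sym)
    ... | tri< _ _ _    | tri> _ _ πx<πx' = contradiction (ρ-sorts (key-mono πx<πx')) (F.<-asym ρfx'<ρfx)
    ... | tri≈ _ refl _ | _ = contradiction fx<fx' (F.<-irrefl refl)
    ... | tri> _ _ x'<x | _ = contradiction (f-mono x'<x) (F.<-asym fx<fx')

universalThreshold : ∀ {N} (G : Graph N) {Cs Is : Fin N → Set} {m} (c i : Fin m → Fin N) →
  Injective _≡_ _≡_ c → Injective _≡_ _≡_ i →
  (∀ v → Cs v ⇔ ∃ λ l → c l ≡ v) → (∀ v → Is v ⇔ ∃ λ j → i j ≡ v) →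
  (∀ j l → Adj G (i j) (c l) ⇔ l F.≤ j) → UniversalThreshold G Cs Is
universalThreshold G {Cs} {m = m} c i c-inj i-inj Cs⇔ Is⇔ threshold =
  m , c , i , c-inj , i-inj , Cs⇔ , Is⇔ , neighbourhood
  where
  neighbourhood : ∀ j w → Cs w → Adj G (i j) w ⇔ ∃ λ l → c l ≡ w × l F.≤ j
  neighbourhood j w Cw with l , refl ← Equivalence.to (Cs⇔ w) Cw =
    mk⇔ (λ adj → l , refl , Equivalence.to (threshold j l) adj)
        (λ { (l' , cl'≡cl , l'≤j) →
               subst (Adj G (i j)) cl'≡cl (Equivalence.from (threshold j l') l'≤j) })

-- Doubling a split permutation diagram

Key : Set
Key = ℕ × ℕ × ℕ

keyOrder : B.StrictTotalOrder 0ℓ 0ℓ 0ℓ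
keyOrder = ×-strictTotalOrder ℕ.<-strictTotalOrder
             (×-strictTotalOrder ℕ.<-strictTotalOrder ℕ.<-strictTotalOrder)

infix 4 _<ₖ_
_<ₖ_ : Key → Key → Set
_<ₖ_ = B.StrictTotalOrder._<_ keyOrder

<ₖ-fst : ∀ {a a' b b' c c'} → a < a' → (a , b , c) <ₖ (a' , b' , c')
<ₖ-fst = inj₁

<ₖ-snd : ∀ {a a' b b' c c'} → a ≤ a' → b < b' → (a , b , c) <ₖ (a' , b' , c')
<ₖ-snd a≤a' b<b' with ℕ.m≤n⇒m<n∨m≡n a≤a'
... | inj₁ a<a' = inj₁ a<a'
... | inj₂ a≡a' = inj₂ (a≡a' , inj₁ b<b')

<ₖ-thd : ∀ {a a' b c c'} → a ≤ a' → c < c' → (a , b , c) <ₖ (a' , b , c')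
<ₖ-thd a≤a' c<c' with ℕ.m≤n⇒m<n∨m≡n a≤a'
... | inj₁ a<a' = inj₁ a<a'
... | inj₂ a≡a' = inj₂ (a≡a' , inj₂ (refl , c<c'))

module TwinExtension {n} (π : Permutation′ n) (clique : Fin n → Bool)
  (clique-decreasing : ∀ {x x'} → clique x ≡ true → clique x' ≡ true → x F.< x' →
                       π ⟨$⟩ˡ x' F.< π ⟨$⟩ˡ x)
  (independent-increasing : ∀ {x x'} → clique x ≡ false → clique x' ≡ false → x F.< x' →
                            π ⟨$⟩ˡ x F.< π ⟨$⟩ˡ x')
  where

  height : Fin n → ℕ
  height x = suc (toℕ (π ⟨$⟩ˡ x))

  height-injective : ∀ {x x'} → height x ≡ height x' → x ≡ x'
  height-injective = ⟨$⟩ˡ-injective π ∘ toℕ-injective ∘ ℕ.suc-injective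

  0<height : ∀ {x} → 0 < height x
  0<height = s≤s z≤n

  height<1+n : ∀ {x} → height x < suc n
  height<1+n = s≤s (toℕ<n _)

  height-clique : ∀ {x x'} → clique x ≡ true → clique x' ≡ true → x F.< x' → height x' < height x
  height-clique cx cx' = s≤s ∘ clique-decreasing cx cx'

  height-independent : ∀ {x x'} → clique x ≡ false → clique x' ≡ false → x F.< x' → height x < height x'
  height-independent cx cx' = s≤s ∘ independent-increasing cx cx'

  CliqueAboveUpTo : Fin n → Set
  CliqueAboveUpTo x =
      (clique x ≡ true  → ∀ z → clique z ≡ false → z F.< x → height z < height x)
    × (clique x ≡ false → ∀ z → clique z ≡ true  → z F.< x → height x < height z)

  cliqueAboveUpTo? : ∀ x → Dec (CliqueAboveUpTo x)
  cliqueAboveUpTo? x =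
          (clique x ≟ᵇ true  →-dec F.all? λ z →
             clique z ≟ᵇ false →-dec (z F.<? x →-dec height z ℕ.<? height x))
    ×-dec (clique x ≟ᵇ false →-dec F.all? λ z →
             clique z ≟ᵇ true  →-dec (z F.<? x →-dec height x ℕ.<? height z))

  cliqueAboveUpTo-downClosed : ∀ {x x'} → x' F.< x → CliqueAboveUpTo x → CliqueAboveUpTo x'
  cliqueAboveUpTo-downClosed {x} {x'} x'<x (above , below) = above' , below'
    where
    above' : clique x' ≡ true → ∀ z → clique z ≡ false → z F.< x' → height z < height x'
    above' cx' z cz z<x' with clique x in cx
    ... | true  = ℕ.<-trans (above refl z cz (F.<-trans z<x' x'<x)) (height-clique cx' cx x'<x)
    ... | false = ℕ.<-trans (height-independent cz cx (F.<-trans z<x' x'<x)) (below refl x' cx' x'<x)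

    below' : clique x' ≡ false → ∀ z → clique z ≡ true → z F.< x' → height x' < height z
    below' cx' z cz z<x' with clique x in cx
    ... | true  = ℕ.<-trans (above refl x' cx' x'<x) (height-clique cz cx (F.<-trans z<x' x'<x))
    ... | false = ℕ.<-trans (height-independent cx' cx x'<x) (below refl z cz (F.<-trans z<x' x'<x))

  -- Opaque, so that with-abstracting clique x in the proofs below leaves left x untouched.
  opaque
    left : Fin n → Bool
    left x = does (cliqueAboveUpTo? x)

    left-downClosed : ∀ {x x'} → x' F.< x → left x ≡ true → left x' ≡ true
    left-downClosed x'<x lx =
      dec-true (cliqueAboveUpTo? _) (cliqueAboveUpTo-downClosed x'<x (dec-true⁻¹ (cliqueAboveUpTo? _) lx))

    right-upClosed : ∀ {x x'} → x F.< x' → left x ≡ false → left x' ≡ false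
    right-upClosed x<x' lx =
      dec-false (cliqueAboveUpTo? _) (dec-false⁻¹ (cliqueAboveUpTo? _) lx ∘ cliqueAboveUpTo-downClosed x<x')

    cliqueAbove-left : ∀ {a b} → left a ≡ true → left b ≡ true → clique a ≡ true → clique b ≡ false →
      height b < height a
    cliqueAbove-left {a} {b} la lb ca cb with F.<-cmp a b
    ... | tri< a<b _ _ = proj₂ (dec-true⁻¹ (cliqueAboveUpTo? b) lb) cb a ca a<b
    ... | tri≈ _ refl _ = contradiction cb (not-¬ ca)
    ... | tri> _ _ b<a = proj₁ (dec-true⁻¹ (cliqueAboveUpTo? a) la) ca b cb b<a

    -- Beyond the left part the order flips: an inverted pair would put its earlier point in the left part.
    cliqueBelow-right : ∀ {a b} → left a ≡ false → left b ≡ false → clique a ≡ true → clique b ≡ false →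
      height a < height b
    cliqueBelow-right {a} {b} la lb ca cb with ℕ.<-cmp (height a) (height b)
    ... | tri< ha<hb _ _ = ha<hb
    ... | tri≈ _ ha≡hb _ =
      contradiction (subst (λ x → clique x ≡ false) (sym (height-injective ha≡hb)) cb) (not-¬ ca)
    ... | tri> _ _ hb<ha = contradiction (F.<-cmp a b) (inverted hb<ha)
      where
      inverted : height b < height a → ¬ Tri (a F.< b) (a ≡ b) (b F.< a)
      inverted hb<ha (tri< a<b _ _) = dec-false⁻¹ (cliqueAboveUpTo? a) la
        ( (λ _ z cz z<a → ℕ.<-trans (height-independent cz cb (F.<-trans z<a a<b)) hb<ha)
        , (λ ca' → contradiction ca' (not-¬ ca)))
      inverted hb<ha (tri≈ _ refl _) = contradiction cb (not-¬ ca)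
      inverted hb<ha (tri> _ _ b<a) = dec-false⁻¹ (cliqueAboveUpTo? b) lb
        ( (λ cb' → contradiction cb' (not-¬ cb))
        , (λ _ z cz z<b → ℕ.<-trans hb<ha (height-clique cz ca (F.<-trans z<b b<a))))

  Before After : Bool → Fin n → Pred (Fin n) 0ℓ
  Before t x z = clique z ≡ t × z F.< x
  After  t x z = clique z ≡ t × x F.< z

  before? : ∀ t x → Decidable (Before t x)
  before? t x z = clique z ≟ᵇ t ×-dec z F.<? x

  after? : ∀ t x → Decidable (After t x)
  after? t x z = clique z ≟ᵇ t ×-dec x F.<? z

  maxBefore maxAfter minBefore minAfter : Bool → Fin n → ℕ
  maxBefore t x = maxOver (before? t x) height
  maxAfter  t x = maxOver (after? t x) height
  minBefore t x = minOver (before? t x) height (suc n)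
  minAfter  t x = minOver (after? t x) height (suc n)

  -- Vertex (x , t) of H is the original of x when t is the type of x and its twin otherwise.  Keys are
  -- heights refined lexicographically: originals sit at level 1; a twin is put next to the last earlier
  -- point of its type in the left part and next to the first later one in the right part, at level 2
  -- just above it or at level 0 just below it; the last component orders twins with the same neighbour.
  keyOf : (c l t : Bool) → Fin n → Key
  keyOf true  _     true  x = height x , 1 , 0
  keyOf false _     false x = height x , 1 , 0
  keyOf true  true  false x = maxBefore false x , 2 , toℕ x
  keyOf false true  true  x = minBefore true x , 0 , n ∸ toℕ x
  keyOf false false true  x = maxAfter true x , 2 , n ∸ toℕ x
  keyOf true  false false x = minAfter false x , 0 , toℕ x

  key : Fin n → Bool → Key
  key x t = keyOf (clique x) (left x) t x

  key-original : ∀ x → key x (clique x) ≡ (height x , 1 , 0)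
  key-original x with clique x
  ... | true  = refl
  ... | false = refl

  0<minBefore : ∀ {t x} → 0 < minBefore t x
  0<minBefore {t} {x} = <-minOver (before? t x) height (s≤s z≤n) (λ _ → 0<height)

  0<minAfter : ∀ {t x} → 0 < minAfter t x
  0<minAfter {t} {x} = <-minOver (after? t x) height (s≤s z≤n) (λ _ → 0<height)

  n∸-decreasing : ∀ {x x' : Fin n} → x F.< x' → n ∸ toℕ x' < n ∸ toℕ x
  n∸-decreasing {x' = x'} x<x' = ℕ.∸-monoʳ-< x<x' (ℕ.<⇒≤ (toℕ<n x'))

  key-clique-decreasing : ∀ {x x'} → x F.< x' → key x' true <ₖ key x true
  key-clique-decreasing {x} {x'} x<x' with clique x in cx | left x in lx | clique x' in cx' | left x' in lx'
  ... | true  | _     | true  | _     = <ₖ-fst (height-clique cx cx' x<x')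
  ... | true  | _     | false | true  = <ₖ-snd (minOver-≤ (before? true x') height (suc n) (cx , x<x')) (s≤s z≤n)
  ... | true  | _     | false | false = <ₖ-fst (maxOver-< (after? true x') height 0<height
                                          λ (cz , x'<z) → height-clique cx cz (F.<-trans x<x' x'<z))
  ... | false | true  | true  | _     = <ₖ-fst (<-minOver (before? true x) height height<1+n
                                          λ (cz , z<x) → height-clique cz cx' (F.<-trans z<x x<x'))
  ... | false | false | true  | _     = <ₖ-snd (≤-maxOver (after? true x) height (cx' , x<x')) (s≤s (s≤s z≤n))
  ... | false | true  | false | true  = <ₖ-thd (minOver-antitone (before? true x) (before? true x') height
                                          (λ (cz , z<x) → cz , F.<-trans z<x x<x') (suc n)) (n∸-decreasing x<x')
  ... | false | true  | false | false = <ₖ-fst (maxOver-< (after? true x') height 0<minBefore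
                                          λ (cz , x'<z) → <-minOver (before? true x) height height<1+n
                                            λ (cz' , z'<x) → height-clique cz' cz
                                                               (F.<-trans z'<x (F.<-trans x<x' x'<z)))
  ... | false | false | false | true  = contradiction (trans (sym lx) (left-downClosed {x'} {x} x<x' lx')) λ ()
  ... | false | false | false | false = <ₖ-thd (maxOver-mono (after? true x') (after? true x) height
                                          (λ (cz , x'<z) → cz , F.<-trans x<x' x'<z)) (n∸-decreasing x<x')

  key-independent-increasing : ∀ {x x'} → x F.< x' → key x false <ₖ key x' false
  key-independent-increasing {x} {x'} x<x' with clique x in cx | left x in lx | clique x' in cx' | left x' in lx'
  ... | false | _     | false | _     = <ₖ-fst (height-independent cx cx' x<x')
  ... | false | _     | true  | true  = <ₖ-snd (≤-maxOver (before? false x') height (cx , x<x')) (s≤s (s≤s z≤n))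
  ... | false | _     | true  | false = <ₖ-fst (<-minOver (after? false x') height height<1+n
                                          λ (cz , x'<z) → height-independent cx cz (F.<-trans x<x' x'<z))
  ... | true  | true  | false | _     = <ₖ-fst (maxOver-< (before? false x) height 0<height
                                          λ (cz , z<x) → height-independent cz cx' (F.<-trans z<x x<x'))
  ... | true  | false | false | _     = <ₖ-snd (minOver-≤ (after? false x) height (suc n) (cx' , x<x')) (s≤s z≤n)
  ... | true  | true  | true  | true  = <ₖ-thd (maxOver-mono (before? false x) (before? false x') height
                                          (λ (cz , z<x) → cz , F.<-trans z<x x<x')) x<x'
  ... | true  | true  | true  | false = <ₖ-fst (maxOver-< (before? false x) height 0<minAfter
                                          λ (cz , z<x) → <-minOver (after? false x') height height<1+n
                                            λ (cz' , x'<z') → height-independent cz cz'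
                                                                (F.<-trans z<x (F.<-trans x<x' x'<z')))
  ... | true  | false | true  | true  = contradiction (trans (sym lx) (left-downClosed {x'} {x} x<x' lx')) λ ()
  ... | true  | false | true  | false = <ₖ-thd (minOver-antitone (after? false x') (after? false x) height
                                          (λ (cz , x'<z) → cz , F.<-trans x<x' x'<z) (suc n)) x<x'

  key-left-cliqueAbove : ∀ {x x'} → left x ≡ true → left x' ≡ true → key x' false <ₖ key x true
  key-left-cliqueAbove {x} {x'} lx lx' with clique x in cx | left x in ex | clique x' in cx' | left x' in ex'
  ... | true  | true  | false | true  = <ₖ-fst (cliqueAbove-left ex ex' cx cx')
  ... | true  | true  | true  | true  = <ₖ-fst (maxOver-< (before? false x') height 0<height
                                          λ (cz , z<x') → cliqueAbove-left ex (left-downClosed z<x' ex') cx cz)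
  ... | false | true  | false | true  = <ₖ-fst (<-minOver (before? true x) height height<1+n
                                          λ (cz , z<x) → cliqueAbove-left (left-downClosed z<x ex) ex' cz cx')
  ... | false | true  | true  | true  = <ₖ-fst (maxOver-< (before? false x') height 0<minBefore
                                          λ (cz , z<x') → <-minOver (before? true x) height height<1+n
                                            λ (cz' , z'<x) → cliqueAbove-left (left-downClosed z'<x ex)
                                                                             (left-downClosed z<x' ex') cz' cz)
  ... | _     | false | _     | _     = contradiction lx λ ()
  ... | _     | true  | _     | false = contradiction lx' λ ()

  key-right-cliqueBelow : ∀ {x x'} → left x ≡ false → left x' ≡ false → key x true <ₖ key x' false
  key-right-cliqueBelow {x} {x'} lx lx' with clique x in cx | left x in ex | clique x' in cx' | left x' in ex'
  ... | true  | false | false | false = <ₖ-fst (cliqueBelow-right ex ex' cx cx')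
  ... | true  | false | true  | false = <ₖ-fst (<-minOver (after? false x') height height<1+n
                                          λ (cz , x'<z) → cliqueBelow-right ex (right-upClosed x'<z ex') cx cz)
  ... | false | false | false | false = <ₖ-fst (maxOver-< (after? true x) height 0<height
                                          λ (cz , x<z) → cliqueBelow-right (right-upClosed x<z ex) ex' cz cx')
  ... | false | false | true  | false = <ₖ-fst (maxOver-< (after? true x) height 0<minAfter
                                          λ (cz , x<z) → <-minOver (after? false x') height height<1+n
                                            λ (cz' , x'<z') → cliqueBelow-right (right-upClosed x<z ex)
                                                                               (right-upClosed x'<z' ex') cz cz')
  ... | _     | true  | _     | _     = contradiction lx λ ()
  ... | _     | false | _     | true  = contradiction lx' λ ()

  -- The two copies of x occupy positions 2x and 2x + 1; the clique copy comes first in the left part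
  -- and second in the right part.
  open Inverse 2↔Bool using (strictlyInverseˡ; strictlyInverseʳ) renaming (to to toBool; from to fromBool)

  slot : Fin n → Bool → Fin 2
  slot x t = fromBool (left x xor t)

  vertex : Fin n → Bool → Fin (n * 2)
  vertex x t = combine x (slot x t)

  point : Fin (n * 2) → Fin n
  point v = proj₁ (remQuot {n} 2 v)

  side : Fin (n * 2) → Bool
  side v = left (point v) xor toBool (proj₂ (remQuot {n} 2 v))

  point-vertex : ∀ x t → point (vertex x t) ≡ x
  point-vertex x t = cong proj₁ (F.remQuot-combine {n} {2} x (slot x t))

  side-vertex : ∀ x t → side (vertex x t) ≡ t
  side-vertex x t = begin
    side (vertex x t)             ≡⟨ cong (λ (y , j) → left y xor toBool j)
                                          (F.remQuot-combine {n} {2} x (slot x t)) ⟩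
    left x xor toBool (slot x t)  ≡⟨ cong (left x xor_) (strictlyInverseˡ _) ⟩
    left x xor (left x xor t)     ≡⟨ xor-cancelˡ (left x) t ⟩
    t                             ∎
    where open ≡-Reasoning

  vertex-point-side : ∀ v → vertex (point v) (side v) ≡ v
  vertex-point-side v = begin
    combine x (fromBool (left x xor (left x xor toBool j)))
      ≡⟨ cong (combine x ∘ fromBool) (xor-cancelˡ (left x) _) ⟩
    combine x (fromBool (toBool j))                          ≡⟨ cong (combine x) (strictlyInverseʳ j) ⟩
    combine x j                                              ≡⟨ F.combine-remQuot {n} 2 v ⟩
    v                                                        ∎
    where
    open ≡-Reasoning
    x : Fin n
    x = point v
    j : Fin 2
    j = proj₂ (remQuot {n} 2 v)

  vertex-injective : ∀ {x x' t t'} → vertex x t ≡ vertex x' t' → x ≡ x' × t ≡ t'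
  vertex-injective {x} {x'} {t} {t'} eq =
    trans (sym (point-vertex x t)) (trans (cong point eq) (point-vertex x' t')) ,
    trans (sym (side-vertex x t)) (trans (cong side eq) (side-vertex x' t'))

  vertex-mono : ∀ {x x' t t'} → x F.< x' → vertex x t F.< vertex x' t'
  vertex-mono = F.combine-monoˡ-< _ _

  point-mono : ∀ {u v} → side u ≡ side v → u F.< v → point u F.< point v
  point-mono {u} {v} su≡sv u<v with F.<-cmp (point u) (point v)
  ... | tri< pu<pv _ _ = pu<pv
  ... | tri≈ _ pu≡pv _ = contradiction u≡v (F.<⇒≢ u<v)
    where
    u≡v : u ≡ v
    u≡v = trans (sym (vertex-point-side u)) (trans (cong₂ vertex pu≡pv su≡sv) (vertex-point-side v))
  ... | tri> _ _ pv<pu =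
    contradiction (subst₂ F._<_ (vertex-point-side v) (vertex-point-side u) (vertex-mono pv<pu)) (F.<-asym u<v)

  vertex-slot : ∀ {x l} t → left x ≡ l → vertex x t ≡ combine x (fromBool (l xor t))
  vertex-slot {x} t lx = cong (λ l → combine x (fromBool (l xor t))) lx

  clique-first : ∀ {x x'} → left x ≡ true → left x' ≡ true → vertex x true F.< vertex x' false ⇔ x F.≤ x'
  clique-first {x} {x'} lx lx' = subst₂ (λ u v → u F.< v ⇔ x F.≤ x')
    (sym (vertex-slot true lx)) (sym (vertex-slot false lx')) combine-0<combine-1

  independent-first : ∀ {x x'} → left x ≡ false → left x' ≡ false → vertex x false F.< vertex x' true ⇔ x F.≤ x'
  independent-first {x} {x'} lx lx' = subst₂ (λ u v → u F.< v ⇔ x F.≤ x')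
    (sym (vertex-slot false lx)) (sym (vertex-slot true lx')) combine-0<combine-1

  keyAt : Fin (n * 2) → Key
  keyAt v = key (point v) (side v)

  keyAt-vertex : ∀ x t → keyAt (vertex x t) ≡ key x t
  keyAt-vertex x t = cong₂ key (point-vertex x t) (side-vertex x t)

  ρ : Permutation′ (n * 2)
  ρ = proj₁ (sortingPermutation keyOrder keyAt)

  H : Graph (n * 2)
  H = permutationGraph ρ

  open SortedPoints keyOrder keyAt ρ (proj₂ (sortingPermutation keyOrder keyAt))

  H-isSplitPartition : IsSplitPartition H side
  H-isSplitPartition = isSplitPartition side clique-keys independent-keys
    where
    clique-keys : ∀ {u v} → side u ≡ true → side v ≡ true → u F.< v → keyAt v <ₖ keyAt u
    clique-keys {u} {v} su sv u<v =
      subst₂ (λ t t' → key (point v) t <ₖ key (point u) t') (sym sv) (sym su)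
      (key-clique-decreasing (point-mono (trans su (sym sv)) u<v))

    independent-keys : ∀ {u v} → side u ≡ false → side v ≡ false → u F.< v → keyAt u <ₖ keyAt v
    independent-keys {u} {v} su sv u<v =
      subst₂ (λ t t' → key (point u) t <ₖ key (point v) t') (sym su) (sym sv)
      (key-independent-increasing (point-mono (trans su (sym sv)) u<v))

  m : ℕ
  m = proj₁ (downClosed⇒initialSegment left left-downClosed)

  m≤n : m ≤ n
  m≤n = proj₁ (proj₂ (downClosed⇒initialSegment left left-downClosed))

  left⇔ : ∀ x → left x ≡ true ⇔ toℕ x < m
  left⇔ = proj₂ (proj₂ (downClosed⇒initialSegment left left-downClosed))

  part⇔image : ∀ {k} (xs : Fin k → Fin n) {b} →
    (∀ j → left (xs j) ≡ b) → (∀ {x} → left x ≡ b → ∃ λ j → xs j ≡ x) →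
    ∀ t v → (side v ≡ t × left (point v) ≡ b) ⇔ ∃ λ j → vertex (xs j) t ≡ v
  part⇔image xs {b} in-part onto t v = mk⇔ to from
    where
    to : side v ≡ t × left (point v) ≡ b → ∃ λ j → vertex (xs j) t ≡ v
    to (refl , lv) with j , xsj≡pv ← onto lv =
      j , trans (cong (λ x → vertex x (side v)) xsj≡pv) (vertex-point-side v)

    from : (∃ λ j → vertex (xs j) t ≡ v) → side v ≡ t × left (point v) ≡ b
    from (j , refl) = side-vertex (xs j) t , trans (cong left (point-vertex (xs j) t)) (in-part j)

  leftPoint : Fin m → Fin n
  leftPoint j = F.inject≤ j m≤n

  leftPoint-left : ∀ j → left (leftPoint j) ≡ true
  leftPoint-left j =
    Equivalence.from (left⇔ (leftPoint j)) (subst (_< m) (sym (F.toℕ-inject≤ j m≤n)) (toℕ<n j))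

  leftPoint-onto : ∀ {x} → left x ≡ true → ∃ λ j → leftPoint j ≡ x
  leftPoint-onto {x} lx = fromℕ< x<m , toℕ-injective (trans (F.toℕ-inject≤ _ m≤n) (toℕ-fromℕ< x<m))
    where
    x<m : toℕ x < m
    x<m = Equivalence.to (left⇔ x) lx

  leftPoint-injective : Injective _≡_ _≡_ leftPoint
  leftPoint-injective = F.inject≤-injective m≤n m≤n _ _

  rightPoint : Fin (n ∸ m) → Fin n
  rightPoint j = F.opposite (F.inject≤ j n∸m≤n)
    where
    n∸m≤n : n ∸ m ≤ n
    n∸m≤n = ℕ.m∸n≤m n m

  rightPoint-right : ∀ j → left (rightPoint j) ≡ false
  rightPoint-right j = ¬-not λ lx → ℕ.<⇒≱ (Equivalence.to (left⇔ (rightPoint j)) lx) m≤rightPoint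
    where
    open ℕ.≤-Reasoning
    m≤rightPoint : m ≤ toℕ (rightPoint j)
    m≤rightPoint = begin
      m                              ≡⟨ ℕ.m∸[m∸n]≡n m≤n ⟨
      n ∸ (n ∸ m)                    ≤⟨ ℕ.∸-monoʳ-≤ n (toℕ<n j) ⟩
      n ∸ suc (toℕ j)                ≡⟨ cong (λ a → n ∸ suc a) (F.toℕ-inject≤ j _) ⟨
      n ∸ suc (toℕ (F.inject≤ j _))  ≡⟨ F.opposite-prop _ ⟨
      toℕ (rightPoint j)             ∎

  rightPoint-onto : ∀ {x} → left x ≡ false → ∃ λ j → rightPoint j ≡ x
  rightPoint-onto {x} lx = fromℕ< opposite-x< , (begin
    F.opposite (F.inject≤ (fromℕ< opposite-x<) _)  ≡⟨ cong F.opposite inject-opposite ⟩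
    F.opposite (F.opposite x)                      ≡⟨ F.opposite-involutive x ⟩
    x                                              ∎)
    where
    open ≡-Reasoning
    m≤x : m ≤ toℕ x
    m≤x = ℕ.≮⇒≥ λ x<m → not-¬ lx (Equivalence.from (left⇔ x) x<m)

    opposite-x< : toℕ (F.opposite x) < n ∸ m
    opposite-x< = subst (_< n ∸ m) (sym (F.opposite-prop x)) (ℕ.∸-monoʳ-< (s≤s m≤x) (toℕ<n x))

    inject-opposite : F.inject≤ (fromℕ< opposite-x<) (ℕ.m∸n≤m n m) ≡ F.opposite x
    inject-opposite = toℕ-injective (trans (F.toℕ-inject≤ _ _) (toℕ-fromℕ< opposite-x<))

  rightPoint-injective : Injective _≡_ _≡_ rightPoint
  rightPoint-injective {j} {j'} eq = F.inject≤-injective _ _ j j' (begin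
    F.inject≤ j _               ≡⟨ F.opposite-involutive _ ⟨
    F.opposite (rightPoint j)   ≡⟨ cong F.opposite eq ⟩
    F.opposite (rightPoint j')  ≡⟨ F.opposite-involutive _ ⟩
    F.inject≤ j' _              ∎)
    where open ≡-Reasoning

  leftThreshold : UniversalThreshold H (λ v → side v ≡ true × left (point v) ≡ true)
                                       (λ v → side v ≡ false × left (point v) ≡ true)
  leftThreshold = universalThreshold H c i
    (leftPoint-injective ∘ proj₁ ∘ vertex-injective) (leftPoint-injective ∘ proj₁ ∘ vertex-injective)
    (part⇔image leftPoint leftPoint-left leftPoint-onto true)
    (part⇔image leftPoint leftPoint-left leftPoint-onto false)
    threshold
    where
    c i : Fin m → Fin (n * 2)
    c l = vertex (leftPoint l) true
    i j = vertex (leftPoint j) false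

    threshold : ∀ j l → Adj H (i j) (c l) ⇔ l F.≤ j
    threshold j l =
      inject≤-≤
      ⇔-∘ (clique-first (leftPoint-left l) (leftPoint-left j)
      ⇔-∘ (PermAdj-keyAbove (subst₂ _<ₖ_ (sym (keyAt-vertex _ _)) (sym (keyAt-vertex _ _))
                                         (key-left-cliqueAbove (leftPoint-left l) (leftPoint-left j)))
      ⇔-∘ Adj-permutationGraph ρ (i j) (c l)))

  rightThreshold : UniversalThreshold H (λ v → side v ≡ true × left (point v) ≡ false)
                                        (λ v → side v ≡ false × left (point v) ≡ false)
  rightThreshold = universalThreshold H c i
    (rightPoint-injective ∘ proj₁ ∘ vertex-injective) (rightPoint-injective ∘ proj₁ ∘ vertex-injective)
    (part⇔image rightPoint rightPoint-right rightPoint-onto true)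
    (part⇔image rightPoint rightPoint-right rightPoint-onto false)
    threshold
    where
    c i : Fin (n ∸ m) → Fin (n * 2)
    c l = vertex (rightPoint l) true
    i j = vertex (rightPoint j) false

    threshold : ∀ j l → Adj H (i j) (c l) ⇔ l F.≤ j
    threshold j l =
      (inject≤-≤ ⇔-∘ opposite-≤)
      ⇔-∘ (independent-first (rightPoint-right j) (rightPoint-right l)
      ⇔-∘ (PermAdj-keyBelow (subst₂ _<ₖ_ (sym (keyAt-vertex _ _)) (sym (keyAt-vertex _ _))
                                         (key-right-cliqueBelow (rightPoint-right l) (rightPoint-right j)))
      ⇔-∘ Adj-permutationGraph ρ (i j) (c l)))

  H-isSymmetric : IsSymmetricSplitPermutation H
  H-isSymmetric = ((side , H-isSplitPartition) , permutationGraph-isPermutationGraph ρ) ,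
                  side , left ∘ point , H-isSplitPartition , threshold
    where
    threshold : ∀ k → UniversalThreshold H (λ v → side v ≡ true × left (point v) ≡ k)
                                           (λ v → side v ≡ false × left (point v) ≡ k)
    threshold true  = leftThreshold
    threshold false = rightThreshold

  original : Fin n → Fin (n * 2)
  original x = vertex x (clique x)

  original-injective : Injective _≡_ _≡_ original
  original-injective = proj₁ ∘ vertex-injective

  PermAdj⇔Adj-original : ∀ x x' → PermAdj π x x' ⇔ Adj H (original x) (original x')
  PermAdj⇔Adj-original x x' =
    ⇔-sym (Adj-permutationGraph ρ (original x) (original x'))
    ⇔-∘ PermAdj-transfer π original vertex-mono keys x x'
    where
    keyAt-original : ∀ x → keyAt (original x) ≡ (height x , 1 , 0)
    keyAt-original x = trans (keyAt-vertex x (clique x)) (key-original x)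

    keys : ∀ {x x'} → π ⟨$⟩ˡ x F.< π ⟨$⟩ˡ x' → keyAt (original x) <ₖ keyAt (original x')
    keys {x} {x'} πx<πx' =
      subst₂ _<ₖ_ (sym (keyAt-original x)) (sym (keyAt-original x')) (<ₖ-fst (s≤s πx<πx'))

module _ {n} {G : Graph n} {s : Fin n → Bool} (split : IsSplitPartition G s) (π σ : Permutation′ n)
  (iso : ∀ u v → Adj G u v ⇔ PermAdj π (σ ⟨$⟩ʳ u) (σ ⟨$⟩ʳ v)) where

  private
    Adj⇔PermAdj : ∀ x x' → Adj G (σ ⟨$⟩ˡ x) (σ ⟨$⟩ˡ x') ⇔ PermAdj π x x'
    Adj⇔PermAdj x x' =
      subst₂ (λ a b → Adj G (σ ⟨$⟩ˡ x) (σ ⟨$⟩ˡ x') ⇔ PermAdj π a b) (inverseʳ σ) (inverseʳ σ) (iso _ _)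

  split-clique-decreasing : ∀ {x x'} → s (σ ⟨$⟩ˡ x) ≡ true → s (σ ⟨$⟩ˡ x') ≡ true → x F.< x' →
    π ⟨$⟩ˡ x' F.< π ⟨$⟩ˡ x
  split-clique-decreasing {x} {x'} cx cx' x<x'
    with Equivalence.to (Adj⇔PermAdj x x') (proj₁ split _ _ (F.<⇒≢ x<x' ∘ ⟨$⟩ˡ-injective σ) cx cx')
  ... | inj₁ (_ , πx'<πx) = πx'<πx
  ... | inj₂ (x'<x , _) = contradiction x<x' (F.<-asym x'<x)

  split-independent-increasing : ∀ {x x'} → s (σ ⟨$⟩ˡ x) ≡ false → s (σ ⟨$⟩ˡ x') ≡ false → x F.< x' →
    π ⟨$⟩ˡ x F.< π ⟨$⟩ˡ x'
  split-independent-increasing {x} {x'} cx cx' x<x' with F.<-cmp (π ⟨$⟩ˡ x) (π ⟨$⟩ˡ x')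
  ... | tri< πx<πx' _ _ = πx<πx'
  ... | tri≈ _ πx≡πx' _ = contradiction (⟨$⟩ˡ-injective π πx≡πx') (F.<⇒≢ x<x')
  ... | tri> _ _ πx'<πx = contradiction (Equivalence.from (Adj⇔PermAdj x x') (inj₁ (x<x' , πx'<πx)))
                                        (proj₂ split _ _ cx cx')

lemma4p1 : (n : ℕ) (G : Graph n) → IsSplitPermutation G →
    Σ (Graph (2 * n)) λ H → IsSymmetricSplitPermutation H × InducedSubgraphOf G H
lemma4p1 n G ((s , split) , (π , σ , iso)) =
  subst (λ N → Σ (Graph N) λ H → IsSymmetricSplitPermutation H × InducedSubgraphOf G H) (ℕ.*-comm n 2)
    (H , H-isSymmetric , embed , embed-injective , embed-adj)
  where
  open TwinExtension π (λ x → s (σ ⟨$⟩ˡ x)) (split-clique-decreasing {G = G} split π σ iso)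
    (split-independent-increasing {G = G} split π σ iso)

  embed : Fin n → Fin (n * 2)
  embed u = original (σ ⟨$⟩ʳ u)

  embed-injective : Injective _≡_ _≡_ embed
  embed-injective = ⟨$⟩ˡ-injective (P.flip σ) ∘ original-injective

  embed-adj : ∀ u v → adj G u v ≡ adj H (embed u) (embed v)
  embed-adj u v = ≡true⇔⇒≡ (PermAdj⇔Adj-original _ _ ⇔-∘ iso u v)
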